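{- Let $H=(V,E)$ be an undirected graph with $|V|=n$ and maximum degree at most $\Delta$, and let $G=\mathcal{R}(H)$. If $H$ is $\delta$-far from $3$-colorable, then \[ \mathrm{dist}_{\mathrm{DAG}}(G)\ge\left(2+\frac{\delta}{2}\right)n. \]
   Context: $\mathrm{dist}_{\mathrm{DAG}}(G)$ is the minimum number of edges whose deletion makes the digraph $G$ acyclic. An $n$-vertex graph $H$ of maximum degree at most $\Delta$ is $\delta$-far from $3$-colorable if at least $\delta\Delta n/2$ edge deletions are required to make $H$ $3$-colorable. Fix integers $\Delta\ge1$, $t\ge 1$, $r\ge 2$ and a real $\delta>0$ with $\frac{\delta}{2}(1+r)>t\Delta$. The reduction $\mathcal{R}$: given an undirected graph $H=(V,E)$ with vertices having distinct integer IDs, build the digraph $G$ with vertices $y_{v,i},x_{v,i}$ for $v\in V$, $i\in\{1,2,3\}$; $a_{e,i,\ell},b_{e,i,\ell}$ for $e\in E$, $i\in\{1,2,3\}$, $\ell\in[t]$; and $s_{v,i,j,\ell}$ for $v\in V$, ordered pairs $i\ne j$ in $\{1,2,3\}$, $\ell\in[r]$. Edges: selection edges $y_{v,i}\to x_{v,i}$; for each $e=\{u,v\}$ with $u<v$, each $i$ and $\ell\in[t]$: $x_{u,i}\to a_{e,i,\ell}\to y_{v,i}$ and $x_{v,i}\to b_{e,i,\ell}\to y_{u,i}$; for each $v$, $i\ne j$, $\ell\in[r]$: $x_{v,i}\to s_{v,i,j,\ell}\to y_{v,j}$.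
   Formalization: The parameter δ is rational rather than real. -}

module Defs where

open import Data.Nat as ℕ using (ℕ; _<_)
open import Data.Fin using (Fin; punchIn)
open import Data.Fin.Properties using (punchInᵢ≢i)
open import Data.List using (List; length; map; concatMap; allFin; filter; _∷_; [])
open import Data.List.Relation.Unary.All using (All)
open import Data.List.Relation.Unary.Unique.Propositional using (Unique)
open import Data.List.Relation.Binary.Sublist.Propositional using (_⊆_)
open import Data.Product using (_×_; _,_; proj₁; proj₂; ∃)
open import Data.Sum using (_⊎_)
open import Data.Integer using (+_)
open import Data.Rational using (ℚ; _/_)
open import Relation.Binary.PropositionalEquality using (_≡_; _≢_; sym)
open import Relation.Binary.Construct.Closure.Transitive using (TransClosure)
open import Relation.Nullary using (¬_)
open import Relation.Nullary.Decidable using (_⊎-dec_)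
open import Data.Fin using (_≟_)

toℚ : ℕ → ℚ
toℚ m = + m / 1

-- Undirected simple graphs on vertex set Fin n (vertex IDs = Fin order).
-- Edges are listed as pairs (u , v) with u < v, without repetition.

EdgeList : ℕ → Set
EdgeList n = List (Fin n × Fin n)

record SimpleGraph (n : ℕ) : Set where
  field
    edges   : EdgeList n
    ordered : All (λ e → Data.Fin._<_ (proj₁ e) (proj₂ e)) edges
    unique  : Unique edges
open SimpleGraph public

degree : ∀ {n} → EdgeList n → Fin n → ℕ
degree es v = length (filter (λ e → (proj₁ e ≟ v) ⊎-dec (proj₂ e ≟ v)) es)

MaxDegreeAtMost : ∀ {n} → SimpleGraph n → ℕ → Set
MaxDegreeAtMost {n} H Δ = (v : Fin n) → degree (edges H) v ℕ.≤ Δ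

ThreeColorable : ∀ {n} → EdgeList n → Set
ThreeColorable {n} es =
  ∃ λ (c : Fin n → Fin 3) → All (λ e → c (proj₁ e) ≢ c (proj₂ e)) es

DeletionsToThreeColorableAtLeast : ∀ {n} → SimpleGraph n → ℚ → Set
DeletionsToThreeColorableAtLeast H k =
  ∀ (keep : EdgeList _) → keep ⊆ edges H → ThreeColorable keep →
    k Data.Rational.≤ toℚ (length (edges H) ℕ.∸ length keep)

FarFrom3Col : ∀ {n} → SimpleGraph n → ℕ → ℚ → Set
FarFrom3Col {n} H Δ δ =
  DeletionsToThreeColorableAtLeast H (((δ Data.Rational.* toℚ Δ) Data.Rational.* toℚ n) Data.Rational.* Data.Rational.½)

ArcList : Set → Set
ArcList V = List (V × V)

Arc : ∀ {V : Set} → ArcList V → V → V → Set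
Arc as u v = Data.List.Membership.Propositional._∈_ (u , v) as
  where import Data.List.Membership.Propositional

Acyclic : ∀ {V : Set} → ArcList V → Set
Acyclic {V} as = (v : V) → ¬ TransClosure (Arc as) v v

DistDAGAtLeast : ∀ {V : Set} → ArcList V → ℚ → Set
DistDAGAtLeast {V} as k =
  ∀ (keep : ArcList V) → keep ⊆ as → Acyclic keep →
    k Data.Rational.≤ toℚ (length as ℕ.∸ length keep)

module _ {n : ℕ} (H : SimpleGraph n) (t r : ℕ) where

  data RV : Set where
    y : Fin n → Fin 3 → RV
    x : Fin n → Fin 3 → RV
    a : Fin (length (edges H)) → Fin 3 → Fin t → RV
    b : Fin (length (edges H)) → Fin 3 → Fin t → RV
    s : Fin n → (i j : Fin 3) → .(i ≢ j) → Fin r → RV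

  selectionArcs : ArcList RV
  selectionArcs = concatMap (λ v → map (λ i → (y v i , x v i)) (allFin 3)) (allFin n)

  edgeArcs : ArcList RV
  edgeArcs = concatMap (λ k →
      let u = proj₁ (Data.List.lookup (edges H) k)
          v = proj₂ (Data.List.lookup (edges H) k)
      in concatMap (λ i → concatMap (λ ℓ →
           (x u i , a k i ℓ) ∷ (a k i ℓ , y v i) ∷
           (x v i , b k i ℓ) ∷ (b k i ℓ , y u i) ∷ [])
         (allFin t)) (allFin 3))
    (allFin (length (edges H)))

  sArcs : ArcList RV
  sArcs = concatMap (λ v → concatMap (λ i → concatMap (λ j' → concatMap (λ ℓ →
      let j = punchIn i j'
          w = s v i j (λ eq → punchInᵢ≢i i j' (sym eq)) ℓ
      in (x v i , w) ∷ (w , y v j) ∷ [])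
      (allFin r)) (allFin 2)) (allFin 3)) (allFin n)

  RArcs : ArcList RV
  RArcs = selectionArcs Data.List.++ edgeArcs Data.List.++ sArcs

-- Fix an acyclic set of kept arcs of R(H), and call a vertex v of H coloured by i when
-- y_{v,i} → x_{v,i} is its only kept selection arc.  If the selection arcs of v for two colours
-- i ≠ j are both kept, the r detours x_{v,i} → s → y_{v,j} and the r detours x_{v,j} → s → y_{v,i}
-- would close cycles through them, so one of the two bundles loses all its r ≥ 2 detours; hence
-- at least 2 arcs are deleted at every vertex, and 3 at an uncoloured one.  Likewise an edge
-- whose ends are coloured alike loses all t ≥ 1 of its a-detours or all of its b-detours.  The
-- properly coloured edges form a 3-colourable subgraph, and every other edge is charged to an
-- uncoloured end (charged at most Δ times) or to a deleted arc of its own gadget.  With B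
-- uncoloured vertices and E deleted edge-gadget arcs, δΔn/2 ≤ Δ(B + E), and at least
-- 2n + B + E ≥ (2 + δ/2)n arcs are deleted.
module Submission where

open import Defs
open import Data.Bool using (Bool; true; false; if_then_else_; T)
open import Data.Fin as Fin using (Fin; punchIn)
open import Data.Fin.Patterns using (0F; 1F; 2F)
open import Data.Fin.Properties using (punchInᵢ≢i)
open import Data.List as List using (List; []; _∷_; map; concatMap; length; allFin; filter; lookup)
open import Data.List.Properties using (map-tabulate; tabulate-lookup; length-tabulate)
open import Data.List.Membership.Propositional using (_∈_)
open import Data.List.Membership.Propositional.Properties using (∈-allFin)
open import Data.List.Relation.Unary.Any using (here; there)
open import Data.List.Relation.Unary.All as All using (All; []; _∷_)
open import Data.List.Relation.Unary.All.Properties using (all-filter)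
open import Data.List.Relation.Binary.Sublist.Propositional using (_⊆_; []; _∷_; _∷ʳ_)
open import Data.List.Relation.Binary.Sublist.Propositional.Properties using (filter-⊆)
open import Data.Nat as ℕ using (ℕ; suc; _≥_; z≤n; s≤s)
open import Data.Nat.Properties
open import Data.Product using (_×_; _,_; proj₁; proj₂)
open import Data.Product.Properties using (≡-dec)
open import Data.Sum using (_⊎_; inj₁; inj₂)
open import Function using (_∘_; id)
open import Relation.Binary.Construct.Closure.Transitive using (TransClosure; [_]; _∷_; _++_)
open import Relation.Binary.Definitions using (DecidableEquality)
open import Relation.Binary.PropositionalEquality
open import Relation.Nullary using (Dec; yes; no; does; ¬_; ¬?; contradiction)
open import Relation.Nullary.Decidable using (map′; _×-dec_; _⊎-dec_; T?)
open import Relation.Unary using (Decidable)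

-- ℕ's arithmetic is opened inside each module, because lemma6p5 is stated with ℚ's _+_ and _*_.
module ListSum where

  open import Data.Nat using (_+_; _*_; _≤_)
  open import Algebra.Properties.CommutativeSemigroup +-commutativeSemigroup
    using () renaming (interchange to +-interchange)

  private variable
    A B : Set

  ∑ : List A → (A → ℕ) → ℕ
  ∑ []       f = 0
  ∑ (z ∷ zs) f = f z + ∑ zs f

  syntax ∑ L (λ z → e) = ∑[ z ∈ L ] e

  ∑-++ : ∀ (L M : List A) f → ∑ (L List.++ M) f ≡ ∑ L f + ∑ M f
  ∑-++ []      M f = refl
  ∑-++ (z ∷ L) M f = trans (cong (f z +_) (∑-++ L M f)) (sym (+-assoc (f z) _ _))

  ∑-concatMap : ∀ (F : A → List B) L g → ∑ (concatMap F L) g ≡ ∑[ z ∈ L ] ∑ (F z) g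
  ∑-concatMap F []      g = refl
  ∑-concatMap F (z ∷ L) g = trans (∑-++ (F z) (concatMap F L) g) (cong (∑ (F z) g +_) (∑-concatMap F L g))

  ∑-map : ∀ (h : A → B) L f → ∑ (map h L) f ≡ ∑[ z ∈ L ] f (h z)
  ∑-map h []      f = refl
  ∑-map h (z ∷ L) f = cong (f (h z) +_) (∑-map h L f)

  ∑-cong : ∀ (L : List A) {f g} → (∀ z → f z ≡ g z) → ∑ L f ≡ ∑ L g
  ∑-cong []      f≗g = refl
  ∑-cong (z ∷ L) f≗g = cong₂ _+_ (f≗g z) (∑-cong L f≗g)

  ∑-mono-≤ : ∀ (L : List A) {f g} → (∀ z → f z ≤ g z) → ∑ L f ≤ ∑ L g
  ∑-mono-≤ []      f≤g = z≤n
  ∑-mono-≤ (z ∷ L) f≤g = +-mono-≤ (f≤g z) (∑-mono-≤ L f≤g)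

  ∑-distrib-+ : ∀ (L : List A) f g → ∑[ z ∈ L ] (f z + g z) ≡ ∑ L f + ∑ L g
  ∑-distrib-+ []      f g = refl
  ∑-distrib-+ (z ∷ L) f g =
    trans (cong ((f z + g z) +_) (∑-distrib-+ L f g)) (+-interchange (f z) (g z) (∑ L f) (∑ L g))

  ∑-*ˡ : ∀ (L : List A) c f → ∑[ z ∈ L ] (c * f z) ≡ c * ∑ L f
  ∑-*ˡ []      c f = sym (*-zeroʳ c)
  ∑-*ˡ (z ∷ L) c f = trans (cong (c * f z +_) (∑-*ˡ L c f)) (sym (*-distribˡ-+ c (f z) (∑ L f)))

  ∑-*ʳ : ∀ (L : List A) c f → ∑[ z ∈ L ] (f z * c) ≡ ∑ L f * c
  ∑-*ʳ []      c f = refl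
  ∑-*ʳ (z ∷ L) c f = trans (cong (f z * c +_) (∑-*ʳ L c f)) (sym (*-distribʳ-+ c (f z) (∑ L f)))

  ∑-zero : ∀ (L : List A) → ∑[ _ ∈ L ] 0 ≡ 0
  ∑-zero []      = refl
  ∑-zero (_ ∷ L) = ∑-zero L

  ∑-comm : ∀ (L : List A) (M : List B) (f : A → B → ℕ) →
    ∑[ z ∈ L ] ∑[ w ∈ M ] f z w ≡ ∑[ w ∈ M ] ∑[ z ∈ L ] f z w
  ∑-comm []      M f = sym (∑-zero M)
  ∑-comm (z ∷ L) M f = trans (cong (∑ M (f z) +_) (∑-comm L M f)) (sym (∑-distrib-+ M (f z) _))

  ∑-const : ∀ (L : List A) c → ∑[ _ ∈ L ] c ≡ length L * c
  ∑-const []      c = refl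
  ∑-const (_ ∷ L) c = cong (c +_) (∑-const L c)

  ∑-lookup : ∀ (L : List A) f → ∑[ k ∈ allFin (length L) ] f (lookup L k) ≡ ∑ L f
  ∑-lookup L f = begin
    ∑[ k ∈ allFin (length L) ] f (lookup L k) ≡⟨ ∑-map (lookup L) (allFin (length L)) f ⟨
    ∑ (map (lookup L) (allFin (length L))) f
      ≡⟨ cong (λ M → ∑ M f) (trans (map-tabulate id (lookup L)) (tabulate-lookup L)) ⟩
    ∑ L f                                     ∎
    where open ≡-Reasoning

  ∑-concatMap-++ : ∀ (F G : A → List B) L h →
    ∑ (concatMap (λ z → F z List.++ G z) L) h ≡ ∑ (concatMap F L) h + ∑ (concatMap G L) h
  ∑-concatMap-++ F G L h = begin
    ∑ (concatMap (λ z → F z List.++ G z) L) h   ≡⟨ ∑-concatMap (λ z → F z List.++ G z) L h ⟩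
    ∑[ z ∈ L ] ∑ (F z List.++ G z) h             ≡⟨ ∑-cong L (λ z → ∑-++ (F z) (G z) h) ⟩
    ∑[ z ∈ L ] (∑ (F z) h + ∑ (G z) h)           ≡⟨ ∑-distrib-+ L (λ z → ∑ (F z) h) (λ z → ∑ (G z) h) ⟩
    ∑[ z ∈ L ] ∑ (F z) h + ∑[ z ∈ L ] ∑ (G z) h ≡⟨ cong₂ _+_ (∑-concatMap F L h) (∑-concatMap G L h) ⟨
    ∑ (concatMap F L) h + ∑ (concatMap G L) h    ∎
    where open ≡-Reasoning

  ∈⇒≤∑ : ∀ {L : List A} {z} f → z ∈ L → f z ≤ ∑ L f
  ∈⇒≤∑ {L = w ∷ L} f (here refl)  = m≤m+n (f w) _
  ∈⇒≤∑ {L = w ∷ L} f (there z∈L) = ≤-trans (∈⇒≤∑ f z∈L) (m≤n+m _ (f w))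

  ∈⇒∑≤∑-concatMap : ∀ (F : A → List B) {L z} f → z ∈ L → ∑ (F z) f ≤ ∑ (concatMap F L) f
  ∈⇒∑≤∑-concatMap F {L} f z∈L = subst (_ ≤_) (sym (∑-concatMap F L f)) (∈⇒≤∑ (λ z → ∑ (F z) f) z∈L)

  𝟙 : {P : Set} → Dec P → ℕ
  𝟙 P? = if does P? then 1 else 0

  𝟙-yes : {P : Set} (P? : Dec P) → P → 𝟙 P? ≡ 1
  𝟙-yes (yes _)  _ = refl
  𝟙-yes (no ¬p) p = contradiction p ¬p

  𝟙≤ : ∀ {P : Set} {z} (P? : Dec P) → (P → 1 ≤ z) → 𝟙 P? ≤ z
  𝟙≤ (yes p) 1≤z = 1≤z p
  𝟙≤ (no _)  _   = z≤n

  length-filter≡∑𝟙 : ∀ {P : A → Set} (P? : Decidable P) L → length (filter P? L) ≡ ∑[ z ∈ L ] 𝟙 (P? z)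
  length-filter≡∑𝟙 P? []      = refl
  length-filter≡∑𝟙 P? (z ∷ L) with does (P? z)
  ... | true  = cong suc (length-filter≡∑𝟙 P? L)
  ... | false = length-filter≡∑𝟙 P? L

  length≡length-filter+∑𝟙¬ : ∀ {P : A → Set} (P? : Decidable P) L →
    length L ≡ length (filter P? L) + ∑[ z ∈ L ] 𝟙 (¬? (P? z))
  length≡length-filter+∑𝟙¬ P? []      = refl
  length≡length-filter+∑𝟙¬ P? (z ∷ L) with does (P? z)
  ... | true  = cong suc (length≡length-filter+∑𝟙¬ P? L)
  ... | false = trans (cong suc (length≡length-filter+∑𝟙¬ P? L)) (sym (+-suc _ _))

open ListSum

module Incidence where

  open import Data.Nat using (_*_)

  incident? : ∀ {n} (e : Fin n × Fin n) (v : Fin n) → Dec (proj₁ e ≡ v ⊎ proj₂ e ≡ v)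
  incident? e v = (proj₁ e Fin.≟ v) ⊎-dec (proj₂ e Fin.≟ v)

  ∑-weighted-degree : ∀ {n} (es : EdgeList n) (f : Fin n → ℕ) →
    ∑[ e ∈ es ] ∑[ v ∈ allFin n ] (f v * 𝟙 (incident? e v)) ≡ ∑[ v ∈ allFin n ] (f v * degree es v)
  ∑-weighted-degree {n} es f = begin
    ∑[ e ∈ es ] ∑[ v ∈ allFin n ] (f v * 𝟙 (incident? e v))
      ≡⟨ ∑-comm es (allFin n) (λ e v → f v * 𝟙 (incident? e v)) ⟩
    ∑[ v ∈ allFin n ] ∑[ e ∈ es ] (f v * 𝟙 (incident? e v))
      ≡⟨ ∑-cong (allFin n) (λ v → ∑-*ˡ es (f v) (λ e → 𝟙 (incident? e v))) ⟩
    ∑[ v ∈ allFin n ] (f v * ∑[ e ∈ es ] 𝟙 (incident? e v))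
      ≡⟨ ∑-cong (allFin n) (λ v → cong (f v *_) (length-filter≡∑𝟙 (λ e → incident? e v) es)) ⟨
    ∑[ v ∈ allFin n ] (f v * degree es v)
      ∎
    where open ≡-Reasoning

open Incidence

detours : {V A : Set} → V → V → (A → V) → List A → ArcList V
detours X Y w = concatMap (λ l → (X , w l) ∷ (w l , Y) ∷ [])

module DeletedArcs {V : Set} (_≟_ : DecidableEquality V) (keep : ArcList V) where

  open import Data.Nat using (_+_; _∸_; _≤_)
  open import Data.List.Membership.DecPropositional (≡-dec _≟_ _≟_) public using (_∈?_)

  _⇝_ : V → V → Set
  _⇝_ = TransClosure (Arc keep)

  isDeleted : V × V → ℕ
  isDeleted e = 𝟙 (¬? (e ∈? keep))

  deleted : ArcList V → ℕ
  deleted as = ∑ as isDeleted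

  deleted+length≤length : ∀ {ks as} → ks ⊆ as → All (_∈ keep) ks → deleted as + length ks ≤ length as
  deleted+length≤length [] [] = z≤n
  deleted+length≤length {ks} {e ∷ as} (.e ∷ʳ ks⊆as) kept = begin
    isDeleted e + deleted as + length ks
      ≤⟨ +-monoˡ-≤ (length ks) (+-monoˡ-≤ (deleted as) (𝟙≤ (¬? (e ∈? keep)) (λ _ → ≤-refl))) ⟩
    suc (deleted as + length ks)         ≤⟨ s≤s (deleted+length≤length ks⊆as kept) ⟩
    suc (length as)                      ∎
    where open ≤-Reasoning
  deleted+length≤length {e ∷ ks} {.e ∷ as} (refl ∷ ks⊆as) (e∈keep ∷ kept) with e ∈? keep
  ... | yes _     = subst (_≤ suc (length as)) (sym (+-suc (deleted as) (length ks)))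
                        (s≤s (deleted+length≤length ks⊆as kept))
  ... | no e∉keep = contradiction e∈keep e∉keep

  deleted≤length∸length : ∀ {as} → keep ⊆ as → deleted as ≤ length as ∸ length keep
  deleted≤length∸length keep⊆as = m+n≤o⇒m≤o∸n _ (deleted+length≤length keep⊆as (All.tabulate id))

  detours-kept⊎deleted : ∀ {A} X Y (w : A → V) L → X ⇝ Y ⊎ length L ≤ deleted (detours X Y w L)
  detours-kept⊎deleted X Y w []      = inj₂ z≤n
  detours-kept⊎deleted X Y w (l ∷ L) with (X , w l) ∈? keep | (w l , Y) ∈? keep | detours-kept⊎deleted X Y w L
  ... | yes X→w | yes w→Y | _        = inj₁ (X→w ∷ [ w→Y ])
  ... | _       | _       | inj₁ X⇝Y = inj₁ X⇝Y
  ... | no _    | _       | inj₂ L≤  = inj₂ (s≤s (≤-trans L≤ (m≤n+m _ _)))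
  ... | yes _   | no _    | inj₂ L≤  = inj₂ (s≤s L≤)

  opposite-detours-deleted : Acyclic keep → ∀ {X Y X′ Y′} → (Y , X) ∈ keep → (Y′ , X′) ∈ keep →
    ∀ {A} (w w′ : A → V) L → length L ≤ deleted (detours X Y′ w L) + deleted (detours X′ Y w′ L)
  opposite-detours-deleted acyclic {X} {Y} {X′} {Y′} Y→X Y′→X′ w w′ L
    with detours-kept⊎deleted X Y′ w L | detours-kept⊎deleted X′ Y w′ L
  ... | inj₂ L≤   | _         = ≤-trans L≤ (m≤m+n _ _)
  ... | inj₁ _    | inj₂ L≤   = ≤-trans L≤ (m≤n+m _ _)
  ... | inj₁ X⇝Y′ | inj₁ X′⇝Y = contradiction (Y→X ∷ (X⇝Y′ ++ (Y′→X′ ∷ X′⇝Y))) (acyclic Y)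

  interleaved-detours-deleted : Acyclic keep → ∀ {X Y X′ Y′} → (Y , X) ∈ keep → (Y′ , X′) ∈ keep →
    ∀ {A} (w w′ : A → V) L →
    length L ≤ deleted (concatMap (λ l → (X , w l) ∷ (w l , Y′) ∷ (X′ , w′ l) ∷ (w′ l , Y) ∷ []) L)
  interleaved-detours-deleted acyclic {X} {Y} {X′} {Y′} Y→X Y′→X′ w w′ L =
    subst (length L ≤_)
      (sym (∑-concatMap-++ (λ l → (X , w l) ∷ (w l , Y′) ∷ []) (λ l → (X′ , w′ l) ∷ (w′ l , Y) ∷ []) L isDeleted))
      (opposite-detours-deleted acyclic Y→X Y′→X′ w w′ L)

exactlyOne : Bool → Bool → Bool → Bool
exactlyOne true  false false = true
exactlyOne false true  false = true
exactlyOne false false true  = true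
exactlyOne _     _     _     = false

firstTrue : Bool → Bool → Bool → Fin 3
firstTrue true  _     _ = 0F
firstTrue false true  _ = 1F
firstTrue false false _ = 2F

module UniqueChoice {P : Fin 3 → Set} (P? : ∀ i → Dec (P i)) where

  open import Data.Nat using (_+_; _≤_)

  isUnique : Bool
  isUnique = exactlyOne (does (P? 0F)) (does (P? 1F)) (does (P? 2F))

  choice : Fin 3
  choice = firstTrue (does (P? 0F)) (does (P? 1F)) (does (P? 2F))

  choice-holds : T isUnique → P choice
  choice-holds with P? 0F | P? 1F | P? 2F
  ... | yes p | no _  | no _  = λ _ → p
  ... | no _  | yes p | no _  = λ _ → p
  ... | no _  | no _  | yes p = λ _ → p
  ... | yes _ | yes _ | _     = λ ()
  ... | yes _ | no _  | yes _ = λ ()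
  ... | no _  | yes _ | yes _ = λ ()
  ... | no _  | no _  | no _  = λ ()

  notUnique : ℕ
  notUnique = 𝟙 (¬? (T? isUnique))

  failures : ℕ
  failures = 𝟙 (¬? (P? 0F)) + (𝟙 (¬? (P? 1F)) + (𝟙 (¬? (P? 2F)) + 0))

  2+notUnique≤failures+pairs : ∀ {c₀₁ c₀₂ c₁₂} →
    (P 0F → P 1F → 2 ≤ c₀₁) → (P 0F → P 2F → 2 ≤ c₀₂) → (P 1F → P 2F → 2 ≤ c₁₂) →
    2 + notUnique ≤ failures + (c₀₁ + c₀₂ + c₁₂)
  2+notUnique≤failures+pairs {c₀₁} {c₀₂} {c₁₂} p₀₁ p₀₂ p₁₂ with P? 0F | P? 1F | P? 2F
  ... | yes q₀ | yes q₁ | yes q₂ = ≤-trans (n≤1+n 3) (≤-trans (+-mono-≤ (p₀₁ q₀ q₁) (p₀₂ q₀ q₂)) (m≤m+n _ c₁₂))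
  ... | yes q₀ | yes q₁ | no _   = s≤s (≤-trans (p₀₁ q₀ q₁) (≤-trans (m≤m+n c₀₁ c₀₂) (m≤m+n _ c₁₂)))
  ... | yes q₀ | no _   | yes q₂ = s≤s (≤-trans (p₀₂ q₀ q₂) (≤-trans (m≤n+m c₀₂ c₀₁) (m≤m+n _ c₁₂)))
  ... | no _   | yes q₁ | yes q₂ = s≤s (≤-trans (p₁₂ q₁ q₂) (m≤n+m c₁₂ (c₀₁ + c₀₂)))
  ... | yes _  | no _   | no _   = m≤m+n 2 _
  ... | no _   | yes _  | no _   = m≤m+n 2 _
  ... | no _   | no _   | yes _  = m≤m+n 2 _
  ... | no _   | no _   | no _   = m≤m+n 3 _

module _ {n : ℕ} {H : SimpleGraph n} {t r : ℕ} where

  _≟ᴿ_ : DecidableEquality (RV H t r)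
  y v i ≟ᴿ y v′ i′ = map′ (λ { (refl , refl) → refl }) (λ { refl → refl , refl }) (v Fin.≟ v′ ×-dec i Fin.≟ i′)
  x v i ≟ᴿ x v′ i′ = map′ (λ { (refl , refl) → refl }) (λ { refl → refl , refl }) (v Fin.≟ v′ ×-dec i Fin.≟ i′)
  a k i ℓ ≟ᴿ a k′ i′ ℓ′ = map′ (λ { (refl , refl , refl) → refl }) (λ { refl → refl , refl , refl })
    (k Fin.≟ k′ ×-dec i Fin.≟ i′ ×-dec ℓ Fin.≟ ℓ′)
  b k i ℓ ≟ᴿ b k′ i′ ℓ′ = map′ (λ { (refl , refl , refl) → refl }) (λ { refl → refl , refl , refl })
    (k Fin.≟ k′ ×-dec i Fin.≟ i′ ×-dec ℓ Fin.≟ ℓ′)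
  s v i j _ ℓ ≟ᴿ s v′ i′ j′ _ ℓ′ =
    map′ (λ { (refl , refl , refl , refl) → refl }) (λ { refl → refl , refl , refl , refl })
    (v Fin.≟ v′ ×-dec i Fin.≟ i′ ×-dec j Fin.≟ j′ ×-dec ℓ Fin.≟ ℓ′)
  y _ _       ≟ᴿ x _ _       = no λ ()
  y _ _       ≟ᴿ a _ _ _     = no λ ()
  y _ _       ≟ᴿ b _ _ _     = no λ ()
  y _ _       ≟ᴿ s _ _ _ _ _ = no λ ()
  x _ _       ≟ᴿ y _ _       = no λ ()
  x _ _       ≟ᴿ a _ _ _     = no λ ()
  x _ _       ≟ᴿ b _ _ _     = no λ ()
  x _ _       ≟ᴿ s _ _ _ _ _ = no λ ()
  a _ _ _     ≟ᴿ y _ _       = no λ ()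
  a _ _ _     ≟ᴿ x _ _       = no λ ()
  a _ _ _     ≟ᴿ b _ _ _     = no λ ()
  a _ _ _     ≟ᴿ s _ _ _ _ _ = no λ ()
  b _ _ _     ≟ᴿ y _ _       = no λ ()
  b _ _ _     ≟ᴿ x _ _       = no λ ()
  b _ _ _     ≟ᴿ a _ _ _     = no λ ()
  b _ _ _     ≟ᴿ s _ _ _ _ _ = no λ ()
  s _ _ _ _ _ ≟ᴿ y _ _       = no λ ()
  s _ _ _ _ _ ≟ᴿ x _ _       = no λ ()
  s _ _ _ _ _ ≟ᴿ a _ _ _     = no λ ()
  s _ _ _ _ _ ≟ᴿ b _ _ _     = no λ ()

module Deletions {n : ℕ} (H : SimpleGraph n) (t r : ℕ) (keep : ArcList (RV H t r)) (acyclic : Acyclic keep) where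

  open import Data.Nat using (_+_; _*_; _∸_; _≤_)
  open DeletedArcs _≟ᴿ_ keep
  open import Data.Nat.Tactic.RingSolver using (solve-∀)

  Selected : Fin n → Fin 3 → Set
  Selected v i = (y v i , x v i) ∈ keep

  Selected? : ∀ v i → Dec (Selected v i)
  Selected? v i = (y v i , x v i) ∈? keep

  isColoured : Fin n → Bool
  isColoured v = UniqueChoice.isUnique (Selected? v)

  colour : Fin n → Fin 3
  colour v = UniqueChoice.choice (Selected? v)

  colour-selected : ∀ v → T (isColoured v) → Selected v (colour v)
  colour-selected v = UniqueChoice.choice-holds (Selected? v)

  bad : Fin n → ℕ
  bad v = UniqueChoice.notUnique (Selected? v)

  badCount : ℕ
  badCount = ∑ (allFin n) bad

  selectionArcsAt : Fin n → ArcList (RV H t r)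
  selectionArcsAt v = map (λ i → (y v i , x v i)) (allFin 3)

  sDetours : Fin n → (i j : Fin 3) → .(i ≢ j) → ArcList (RV H t r)
  sDetours v i j i≢j = detours (x v i) (y v j) (s v i j i≢j) (allFin r)

  sDetoursFrom : Fin n → Fin 3 → Fin 2 → ArcList (RV H t r)
  sDetoursFrom v i j′ = sDetours v i (punchIn i j′) (punchInᵢ≢i i j′ ∘ sym)

  sArcsAt : Fin n → ArcList (RV H t r)
  sArcsAt v = concatMap (λ i → concatMap (sDetoursFrom v i) (allFin 2)) (allFin 3)

  sDetours-deleted : 2 ≤ r → ∀ v i j .(i≢j : i ≢ j) .(j≢i : j ≢ i) → Selected v i → Selected v j →
    2 ≤ deleted (sDetours v i j i≢j) + deleted (sDetours v j i j≢i)
  sDetours-deleted r≥2 v i j i≢j j≢i i-selected j-selected =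
    ≤-trans r≥2 (subst (_≤ deleted (sDetours v i j i≢j) + deleted (sDetours v j i j≢i)) (length-tabulate id)
      (opposite-detours-deleted acyclic i-selected j-selected (s v i j i≢j) (s v j i j≢i) (allFin r)))

  -- The right-hand side is what deleted (sArcsAt v) unfolds to, one term per pair (i , punchIn i j′).
  pair-up : ∀ d₀₁ d₀₂ d₁₀ d₁₂ d₂₀ d₂₁ →
    (d₀₁ + d₁₀) + (d₀₂ + d₂₀) + (d₁₂ + d₂₁) ≡
    (d₀₁ + (d₀₂ + 0)) + ((d₁₀ + (d₁₂ + 0)) + ((d₂₀ + (d₂₁ + 0)) + 0))
  pair-up = solve-∀

  vertex-deleted : 2 ≤ r → ∀ v → 2 + bad v ≤ deleted (selectionArcsAt v) + deleted (sArcsAt v)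
  vertex-deleted r≥2 v = begin
    2 + notUnique
      ≤⟨ 2+notUnique≤failures+pairs (pair 0F 1F) (pair 0F 2F) (pair 1F 2F) ⟩
    failures + ((d₀₁ + d₁₀) + (d₀₂ + d₂₀) + (d₁₂ + d₂₁))
      ≡⟨ cong (failures +_) (pair-up d₀₁ d₀₂ d₁₀ d₁₂ d₂₀ d₂₁) ⟩
    failures + ∑[ i ∈ allFin 3 ] ∑[ j′ ∈ allFin 2 ] deleted (sDetoursFrom v i j′)
      ≡⟨ cong (failures +_) deleted-sArcsAt ⟨
    deleted (selectionArcsAt v) + deleted (sArcsAt v)
      ∎
    where
    open UniqueChoice (Selected? v)
    open ≤-Reasoning
    pair : ∀ i j .{i≢j : i ≢ j} .{j≢i : j ≢ i} → Selected v i → Selected v j →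
           2 ≤ deleted (sDetours v i j i≢j) + deleted (sDetours v j i j≢i)
    pair i j {i≢j} {j≢i} = sDetours-deleted r≥2 v i j i≢j j≢i
    d₀₁ d₀₂ d₁₀ d₁₂ d₂₀ d₂₁ : ℕ
    d₀₁ = deleted (sDetours v 0F 1F λ ())
    d₀₂ = deleted (sDetours v 0F 2F λ ())
    d₁₀ = deleted (sDetours v 1F 0F λ ())
    d₁₂ = deleted (sDetours v 1F 2F λ ())
    d₂₀ = deleted (sDetours v 2F 0F λ ())
    d₂₁ = deleted (sDetours v 2F 1F λ ())
    deleted-sArcsAt : deleted (sArcsAt v) ≡ ∑[ i ∈ allFin 3 ] ∑[ j′ ∈ allFin 2 ] deleted (sDetoursFrom v i j′)
    deleted-sArcsAt = trans (∑-concatMap (λ i → concatMap (sDetoursFrom v i) (allFin 2)) (allFin 3) isDeleted)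
      (∑-cong (allFin 3) (λ i → ∑-concatMap (sDetoursFrom v i) (allFin 2) isDeleted))

  vertices-deleted : 2 ≤ r → 2 * n + badCount ≤ deleted (selectionArcs H t r) + deleted (sArcs H t r)
  vertices-deleted r≥2 = begin
    2 * n + badCount                                      ≡⟨ cong (_+ badCount) (*-comm 2 n) ⟩
    n * 2 + badCount                                      ≡⟨ cong (λ k → k * 2 + badCount) (length-tabulate {n = n} id) ⟨
    length (allFin n) * 2 + badCount                      ≡⟨ cong (_+ badCount) (∑-const (allFin n) 2) ⟨
    ∑[ _ ∈ allFin n ] 2 + badCount                        ≡⟨ ∑-distrib-+ (allFin n) (λ _ → 2) bad ⟨
    ∑[ v ∈ allFin n ] (2 + bad v)                         ≤⟨ ∑-mono-≤ (allFin n) (vertex-deleted r≥2) ⟩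
    ∑[ v ∈ allFin n ] (deleted (selectionArcsAt v) + deleted (sArcsAt v))
      ≡⟨ ∑-distrib-+ (allFin n) (λ v → deleted (selectionArcsAt v)) (λ v → deleted (sArcsAt v)) ⟩
    ∑[ v ∈ allFin n ] deleted (selectionArcsAt v) + ∑[ v ∈ allFin n ] deleted (sArcsAt v)
      ≡⟨ cong₂ _+_ (∑-concatMap selectionArcsAt (allFin n) isDeleted) (∑-concatMap sArcsAt (allFin n) isDeleted) ⟨
    deleted (selectionArcs H t r) + deleted (sArcs H t r) ∎
    where open ≤-Reasoning

  private
    es = edges H
    m  = length es

  end₁ end₂ : Fin m → Fin n
  end₁ k = proj₁ (lookup es k)
  end₂ k = proj₂ (lookup es k)

  edgeArcsOfColour : Fin m → Fin 3 → ArcList (RV H t r)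
  edgeArcsOfColour k i = concatMap (λ ℓ →
      (x (end₁ k) i , a k i ℓ) ∷ (a k i ℓ , y (end₂ k) i) ∷
      (x (end₂ k) i , b k i ℓ) ∷ (b k i ℓ , y (end₁ k) i) ∷ [])
    (allFin t)

  edgeArcsOf : Fin m → ArcList (RV H t r)
  edgeArcsOf k = concatMap (edgeArcsOfColour k) (allFin 3)

  monochromatic-deleted : 1 ≤ t → ∀ k i → Selected (end₁ k) i → Selected (end₂ k) i → 1 ≤ deleted (edgeArcsOf k)
  monochromatic-deleted t≥1 k i end₁-selected end₂-selected = begin
    1                              ≤⟨ t≥1 ⟩
    t                              ≡⟨ length-tabulate id ⟨
    length (allFin t)
      ≤⟨ interleaved-detours-deleted acyclic end₁-selected end₂-selected (a k i) (b k i) (allFin t) ⟩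
    deleted (edgeArcsOfColour k i) ≤⟨ ∈⇒∑≤∑-concatMap (edgeArcsOfColour k) isDeleted (∈-allFin i) ⟩
    deleted (edgeArcsOf k)         ∎
    where open ≤-Reasoning

  Proper : Fin n × Fin n → Set
  Proper (u , w) = colour u ≢ colour w × T (isColoured u) × T (isColoured w)

  Proper? : ∀ e → Dec (Proper e)
  Proper? (u , w) = ¬? (colour u Fin.≟ colour w) ×-dec T? (isColoured u) ×-dec T? (isColoured w)

  properEdges : EdgeList n
  properEdges = filter Proper? es

  properEdges-colourable : ThreeColorable properEdges
  properEdges-colourable = colour , All.map proj₁ (all-filter Proper? es)

  badEndpoints : Fin n × Fin n → ℕ
  badEndpoints e = ∑[ v ∈ allFin n ] (bad v * 𝟙 (incident? e v))

  bad-endpoint : ∀ e v → ¬ T (isColoured v) → proj₁ e ≡ v ⊎ proj₂ e ≡ v → 1 ≤ badEndpoints e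
  bad-endpoint e v uncoloured incident = subst (_≤ badEndpoints e)
    (cong₂ _*_ (𝟙-yes (¬? (T? (isColoured v))) uncoloured) (𝟙-yes (incident? e v) incident))
    (∈⇒≤∑ (λ v → bad v * 𝟙 (incident? e v)) (∈-allFin v))

  improper-deleted : 1 ≤ t → ∀ k → ¬ Proper (lookup es k) → 1 ≤ badEndpoints (lookup es k) + deleted (edgeArcsOf k)
  improper-deleted t≥1 k improper with T? (isColoured (end₁ k)) | T? (isColoured (end₂ k))
  ... | no uncoloured | _ = ≤-trans (bad-endpoint (lookup es k) (end₁ k) uncoloured (inj₁ refl)) (m≤m+n _ _)
  ... | yes _ | no uncoloured = ≤-trans (bad-endpoint (lookup es k) (end₂ k) uncoloured (inj₂ refl)) (m≤m+n _ _)
  ... | yes end₁-coloured | yes end₂-coloured with colour (end₁ k) Fin.≟ colour (end₂ k)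
  ...   | no differ = contradiction (differ , end₁-coloured , end₂-coloured) improper
  ...   | yes same  = ≤-trans (monochromatic-deleted t≥1 k (colour (end₁ k)) (colour-selected (end₁ k) end₁-coloured)
                          (subst (Selected (end₂ k)) (sym same) (colour-selected (end₂ k) end₂-coloured)))
                        (m≤n+m _ _)

  improperCount : ℕ
  improperCount = ∑[ e ∈ es ] 𝟙 (¬? (Proper? e))

  improperCount≤ : 1 ≤ t → ∀ Δ → MaxDegreeAtMost H Δ → improperCount ≤ badCount * Δ + deleted (edgeArcs H t r)
  improperCount≤ t≥1 Δ maxDegree = begin
    improperCount                                                      ≡⟨ ∑-lookup es (λ e → 𝟙 (¬? (Proper? e))) ⟨
    ∑[ k ∈ allFin m ] 𝟙 (¬? (Proper? (lookup es k)))
      ≤⟨ ∑-mono-≤ (allFin m) (λ k → 𝟙≤ (¬? (Proper? (lookup es k))) (improper-deleted t≥1 k)) ⟩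
    ∑[ k ∈ allFin m ] (badEndpoints (lookup es k) + deleted (edgeArcsOf k))
      ≡⟨ ∑-distrib-+ (allFin m) (λ k → badEndpoints (lookup es k)) (λ k → deleted (edgeArcsOf k)) ⟩
    ∑[ k ∈ allFin m ] badEndpoints (lookup es k) + ∑[ k ∈ allFin m ] deleted (edgeArcsOf k)
      ≡⟨ cong₂ _+_ (∑-lookup es badEndpoints) (sym (∑-concatMap edgeArcsOf (allFin m) isDeleted)) ⟩
    ∑ es badEndpoints + E                                              ≡⟨ cong (_+ E) (∑-weighted-degree es bad) ⟩
    ∑[ v ∈ allFin n ] (bad v * degree es v) + E
      ≤⟨ +-monoˡ-≤ E (∑-mono-≤ (allFin n) (λ v → *-monoʳ-≤ (bad v) (maxDegree v))) ⟩
    ∑[ v ∈ allFin n ] (bad v * Δ) + E                                  ≡⟨ cong (_+ E) (∑-*ʳ (allFin n) Δ bad) ⟩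
    badCount * Δ + E                                                   ∎
    where
    open ≤-Reasoning
    E = deleted (edgeArcs H t r)

  removedEdges≤ : 1 ≤ t → ∀ Δ → MaxDegreeAtMost H (suc Δ) →
    m ∸ length properEdges ≤ suc Δ * (badCount + deleted (edgeArcs H t r))
  removedEdges≤ t≥1 Δ maxDegree = begin
    m ∸ length properEdges
      ≡⟨ cong (_∸ length properEdges) (length≡length-filter+∑𝟙¬ Proper? es) ⟩
    length properEdges + improperCount ∸ length properEdges ≡⟨ m+n∸m≡n (length properEdges) improperCount ⟩
    improperCount                                           ≤⟨ improperCount≤ t≥1 (suc Δ) maxDegree ⟩
    badCount * suc Δ + E
      ≤⟨ +-mono-≤ (≤-reflexive (*-comm badCount (suc Δ))) (m≤n*m E (suc Δ)) ⟩
    suc Δ * badCount + suc Δ * E                            ≡⟨ *-distribˡ-+ (suc Δ) badCount E ⟨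
    suc Δ * (badCount + E)                                  ∎
    where
    open ≤-Reasoning
    E = deleted (edgeArcs H t r)

  RArcs-deleted : 2 ≤ r → 2 * n + (badCount + deleted (edgeArcs H t r)) ≤ deleted (RArcs H t r)
  RArcs-deleted r≥2 = begin
    2 * n + (badCount + E)                    ≡⟨ +-assoc (2 * n) badCount E ⟨
    2 * n + badCount + E                      ≤⟨ +-monoˡ-≤ E (vertices-deleted r≥2) ⟩
    deleted (selectionArcs H t r) + S + E     ≡⟨ +-assoc (deleted (selectionArcs H t r)) S E ⟩
    deleted (selectionArcs H t r) + (S + E)   ≡⟨ cong (deleted (selectionArcs H t r) +_) (+-comm S E) ⟩
    deleted (selectionArcs H t r) + (E + S)
      ≡⟨ cong (deleted (selectionArcs H t r) +_) (∑-++ (edgeArcs H t r) (sArcs H t r) isDeleted) ⟨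
    deleted (selectionArcs H t r) + deleted (edgeArcs H t r List.++ sArcs H t r)
      ≡⟨ ∑-++ (selectionArcs H t r) (edgeArcs H t r List.++ sArcs H t r) isDeleted ⟨
    deleted (RArcs H t r)                     ∎
    where
    open ≤-Reasoning
    E = deleted (edgeArcs H t r)
    S = deleted (sArcs H t r)

module RationalBounds where

  open import Data.Nat.Coprimality using (1-coprimeTo) renaming (sym to coprime-sym)
  open import Data.Integer as ℤ using (+_)
  import Data.Integer.Properties as ℤ
  open import Data.Rational using (mkℚ; _≤_; _+_; _*_; _/_; ½; Positive; *≤*)
  import Data.Rational.Properties as ℚᴾ
  open import Data.Rational.Solver using (module +-*-Solver)

  toℚ≡mkℚ : ∀ m → toℚ m ≡ mkℚ (+ m) 0 (coprime-sym (1-coprimeTo m))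
  toℚ≡mkℚ m = ℚᴾ.normalize-coprime (coprime-sym (1-coprimeTo m))

  toℚ-mono-≤ : ∀ {m k} → m ℕ.≤ k → toℚ m ≤ toℚ k
  toℚ-mono-≤ {m} {k} m≤k rewrite toℚ≡mkℚ m | toℚ≡mkℚ k =
    *≤* (subst₂ ℤ._≤_ (sym (ℤ.*-identityʳ (+ m))) (sym (ℤ.*-identityʳ (+ k))) (ℤ.+≤+ m≤k))

  toℚ-+ : ∀ m k → toℚ (m ℕ.+ k) ≡ toℚ m + toℚ k
  toℚ-+ m k rewrite toℚ≡mkℚ m | toℚ≡mkℚ k =
    cong (_/ 1) (trans (ℤ.pos-+ m k) (sym (cong₂ ℤ._+_ (ℤ.*-identityʳ (+ m)) (ℤ.*-identityʳ (+ k)))))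

  toℚ-* : ∀ m k → toℚ (m ℕ.* k) ≡ toℚ m * toℚ k
  toℚ-* m k rewrite toℚ≡mkℚ m | toℚ≡mkℚ k = cong (_/ 1) (ℤ.pos-* m k)

  toℚ-pos : ∀ k → Positive (toℚ (suc k))
  toℚ-pos k rewrite toℚ≡mkℚ (suc k) = _

  cancel-degree : ∀ δ Δ n k X → δ * toℚ (suc Δ) * toℚ n * ½ ≤ toℚ k → k ℕ.≤ suc Δ ℕ.* X →
    δ * ½ * toℚ n ≤ toℚ X
  cancel-degree δ Δ n k X far k≤ = ℚᴾ.*-cancelˡ-≤-pos (toℚ (suc Δ)) (begin
    toℚ (suc Δ) * (δ * ½ * toℚ n)
      ≡⟨ solve 4 (λ D d h N → D :* (d :* h :* N) := d :* D :* N :* h) refl (toℚ (suc Δ)) δ ½ (toℚ n) ⟩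
    δ * toℚ (suc Δ) * toℚ n * ½   ≤⟨ far ⟩
    toℚ k                         ≤⟨ toℚ-mono-≤ k≤ ⟩
    toℚ (suc Δ ℕ.* X)             ≡⟨ toℚ-* (suc Δ) X ⟩
    toℚ (suc Δ) * toℚ X           ∎)
    where
    open ℚᴾ.≤-Reasoning
    open +-*-Solver
    instance _ = toℚ-pos Δ

  [2+δ/2]n≤ : ∀ δ n X D → δ * ½ * toℚ n ≤ toℚ X → 2 ℕ.* n ℕ.+ X ℕ.≤ D →
    (toℚ 2 + δ * ½) * toℚ n ≤ toℚ D
  [2+δ/2]n≤ δ n X D δn/2≤X 2n+X≤D = begin
    (toℚ 2 + δ * ½) * toℚ n       ≡⟨ ℚᴾ.*-distribʳ-+ (toℚ n) (toℚ 2) (δ * ½) ⟩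
    toℚ 2 * toℚ n + δ * ½ * toℚ n ≤⟨ ℚᴾ.+-monoʳ-≤ (toℚ 2 * toℚ n) δn/2≤X ⟩
    toℚ 2 * toℚ n + toℚ X         ≡⟨ trans (toℚ-+ (2 ℕ.* n) X) (cong (_+ toℚ X) (toℚ-* 2 n)) ⟨
    toℚ (2 ℕ.* n ℕ.+ X)           ≤⟨ toℚ-mono-≤ 2n+X≤D ⟩
    toℚ D                         ∎
    where open ℚᴾ.≤-Reasoning

open RationalBounds
open import Data.Rational using (ℚ; _<_; _*_; _+_; ½; 0ℚ)

lemma6p5 : (Δ t r : ℕ) (δ : ℚ) → Δ ≥ 1 → t ≥ 1 → r ≥ 2 → 0ℚ < δ →
    toℚ t * toℚ Δ < (δ * ½) * (toℚ 1 + toℚ r) →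
    {n : ℕ} (H : SimpleGraph n) → MaxDegreeAtMost H Δ →
    FarFrom3Col H Δ δ →
    DistDAGAtLeast (RArcs H t r) ((toℚ 2 + δ * ½) * toℚ n)
lemma6p5 (suc Δ) t r δ (s≤s z≤n) t≥1 r≥2 _ _ {n} H maxDegree far keep keep⊆RArcs acyclic =
  [2+δ/2]n≤ δ n X (length (RArcs H t r) ℕ.∸ length keep)
    (cancel-degree δ Δ n _ X (far properEdges (filter-⊆ Proper? (edges H)) properEdges-colourable)
      (removedEdges≤ t≥1 Δ maxDegree))
    (≤-trans (RArcs-deleted r≥2) (deleted≤length∸length keep⊆RArcs))
  where
  open Deletions H t r keep acyclic
  open DeletedArcs _≟ᴿ_ keep using (deleted; deleted≤length∸length)
  X = badCount ℕ.+ deleted (edgeArcs H t r)
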